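{- Let $n$ be a positive integer and $N=2n$. Suppose we are given $n$ elements $d_1,d_2,\ldots,d_n \in (\mathbb{Z}/N)^*$ (not necessarily distinct). Then there exists a partition of $\mathbb{Z}/N$ into $n$ two-element subsets $\{x_1,y_1\},\ldots,\{x_n,y_n\}$ such that $x_i-y_i = d_i$ in $\mathbb{Z}/N$ for every $i=1,\ldots,n$ (i.e., the pairs have differences $d_1,\ldots,d_n$).
   Context: $(\mathbb{Z}/N)^*$ denotes the group of units of the ring $\mathbb{Z}/N$, i.e., residues coprime to $N$. A pair $\{x,y\}$ is said to have difference $d$ if $x-y=d$ or $y-x=d$; the labelling of $x_i$ and $y_i$ within each pair may be chosen freely. -}

module Defs where

open import Data.Nat using (ℕ; suc; _+_; _∸_; _*_)
open import Data.Nat.DivMod using (_%_)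
open import Data.Fin using (Fin; toℕ)

-- Subtraction in ℤ/N, with ℤ/N represented by Fin N (canonical residues 0..N-1).
-- Result is given as the canonical residue (a natural number < N).
-- subMod N a b = (a - b) mod N  computed as (a + N - b) % N.
subMod : (N : ℕ) → Fin (suc N) → Fin (suc N) → ℕ
subMod N a b = (toℕ a + (suc N ∸ toℕ b)) % suc N

module Submission where

-- Every d i is odd, being a unit modulo the even number 2n; write d i = 2 h i + 1.
-- For permutations a and c of ℤ/n, the pairs {2 a i, 2 c i + 1} partition ℤ/2n, and
-- pair i has difference d i when c i − a i ≡ h i (odd element first) or
-- c i − a i ≡ h i − d i (even element first) modulo n.  By Hall's theorem, differences
-- c i − a i ≡ t i are realised by permutations of ℤ/n exactly when Σ t ≡ 0, so it remains
-- to choose the orientations: a set E with Σ_{i ∈ E} d i ≡ Σ h i (mod n).  It exists since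
-- the subset sums of k units of ℤ/n take at least min(n, k + 1) values.

open import Defs
open import Data.Nat using (ℕ; suc; _*_; _+_)
open import Data.Nat.Coprimality using (Coprime)
open import Data.Fin using (Fin; toℕ)
open import Data.Sum using (_⊎_; [_,_])
open import Data.Product using (Σ; _×_; ∃₂)
open import Function.Definitions using (Bijective)
open import Relation.Binary.PropositionalEquality using (_≡_)

open import Algebra.Bundles using (AbelianGroup)
open import Algebra.Structures using (IsAbelianGroup)
open import Data.Bool.Base using (Bool; true; false; if_then_else_)
open import Data.Fin.Base as Fin using (fromℕ<; punchIn; cast; combine; remQuot)
open import Data.Fin.Patterns using (0F; 1F)
open import Data.Fin.Permutation using (Permutation′; transpose; _⟨$⟩ʳ_; _⟨$⟩ˡ_; _∘ₚ_; inverseˡ; inverseʳ; id)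
open import Data.Fin.Properties
  using (_≟_; any?; toℕ-fromℕ<; toℕ<n; toℕ-injective; punchInᵢ≢i; cast-involutive; toℕ-cast; toℕ-combine; remQuot-combine; combine-remQuot)
open import Data.Fin.Subset using (Subset; _∈_; _∉_; _⊆_; ∣_∣; ⊤; ⁅_⁆; _∪_) renaming (_-_ to _∖_)
open import Data.Fin.Subset.Properties
  using (_∈?_; ∈⊤; ∣p∣≤n; x∈⁅x⁆; x∈⁅y⁆⇒x≡y; ∣⁅x⁆∣≡1; x∈p∪q⁻; x∈p∪q⁺; p⊆p∪q; p⊂q⇒∣p∣<∣q∣; ⊆-antisym; ⊆⊤; ∣⊤∣≡n; ∣p∣≡n⇒p≡⊤; x∈p∧x≢y⇒x∈p-y; p─q⊆p; x∈p⇒∣p-x∣<∣p∣)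
open import Data.Integer.Base using (ℤ; +_; -_; _-_; _⊖_; 0ℤ; 1ℤ; _%ℕ_; _/ℕ_) renaming (_+_ to _⊕_; _*_ to _⊛_)
open import Data.Integer.DivMod using (n%ℕd<d; a≡a%ℕn+[a/ℕn]*n)
open import Data.Integer.Divisibility.Signed using (_∣_; divides; ∣m⇒∣-m; ∣m∣n⇒∣m+n; ∣m⇒∣m*n; ∣n⇒∣m*n; ∣⇒∣ᵤ)
import Data.Integer.Properties as ℤ
import Data.Integer.Tactic.RingSolver as ℤ-Solver
open import Data.List.Base as List using (List; []; allFin)
open import Data.List.Membership.Propositional using () renaming (_∉_ to _∉ₗ_)
open import Data.List.Membership.Propositional.Properties using (∈-allFin)
import Data.List.Relation.Unary.Any as Any
open import Data.Nat.Base as ℕ using (zero; NonZero; _≤_; _<_; _∸_; _/_; _%_; s≤s)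
open import Data.Nat.Coprimality using (coprime-Bézout)
import Data.Nat.Divisibility as ℕ
open import Data.Nat.DivMod using (%-remove-+ʳ; m<n⇒m%n≡m; m≡m%n+[m/n]*n; m%n<n)
open import Data.Nat.GCD using (module Bézout)
import Data.Nat.Properties as ℕ
import Data.Nat.Tactic.RingSolver as ℕ-Solver
open import Data.Product.Base using (_,_; ∃; proj₁; proj₂; uncurry)
open import Data.Sum.Base as Sum using (inj₁; inj₂)
open import Data.Sum.Function.Propositional using (_⊎-↔_)
open import Data.Vec.Base as Vec using (tabulate; lookup; there)
open import Data.Vec.Functional using (_∷_; head; tail; removeAt; updateAt)
open import Data.Vec.Functional.Properties using (updateAt-updates; updateAt-minimal)
open import Data.Vec.Properties using (lookup∘tabulate; []=⇒lookup; lookup⇒[]=)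
open import Function.Base using (_∘_)
open import Function.Bundles using (_↔_; Inverse; mk↔ₛ′)
open import Function.Construct.Composition using (_↔-∘_)
open import Relation.Binary.PropositionalEquality
  using (_≢_; _≗_; refl; sym; trans; cong; cong₂; subst; subst₂; ≢-sym; module ≡-Reasoning)
open import Relation.Nullary.Decidable using (Dec; yes; no; dec-true; dec-false; _×-dec_; ¬?)
open import Relation.Nullary.Negation using (¬_; contradiction)

transpose-applyˡ : ∀ {k} (i j : Fin k) → transpose i j ⟨$⟩ʳ i ≡ j
transpose-applyˡ i j rewrite dec-true (i ≟ i) refl = refl

transpose-applyʳ : ∀ {k} (i j : Fin k) → transpose i j ⟨$⟩ʳ j ≡ i
transpose-applyʳ i j with j ≟ i
... | yes j≡i = j≡i
... | no _ rewrite dec-true (j ≟ j) refl = refl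

transpose-apply-≢ : ∀ {k} {i j l : Fin k} → l ≢ i → l ≢ j → transpose i j ⟨$⟩ʳ l ≡ l
transpose-apply-≢ {i = i} {j} {l} l≢i l≢j rewrite dec-false (l ≟ i) l≢i | dec-false (l ≟ j) l≢j = refl

⟨$⟩ʳ-injective : ∀ {k} (π : Permutation′ k) {x y : Fin k} → π ⟨$⟩ʳ x ≡ π ⟨$⟩ʳ y → x ≡ y
⟨$⟩ʳ-injective π eq = trans (sym (inverseˡ π)) (trans (cong (π ⟨$⟩ˡ_) eq) (inverseˡ π))

x∉p∖x : ∀ {k} (p : Subset k) (x : Fin k) → x ∉ p ∖ x
x∉p∖x (_ Vec.∷ p) Fin.zero ()
x∉p∖x (_ Vec.∷ p) (Fin.suc x) (there x∈p∖x) = x∉p∖x p x x∈p∖x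

bijective-≗ : {A B : Set} {f : A → B} (g : A ↔ B) → f ≗ Inverse.to g → Bijective _≡_ _≡_ f
bijective-≗ {f = f} g f≗g = injective , surjective
  where
  open Inverse g
  injective : ∀ {w w′} → f w ≡ f w′ → w ≡ w′
  injective {w} {w′} eq =
    trans (sym (strictlyInverseʳ w)) (trans (cong from (trans (sym (f≗g w)) (trans eq (f≗g w′)))) (strictlyInverseʳ w′))
  surjective : ∀ z → ∃ λ w → ∀ {w′} → w′ ≡ w → f w′ ≡ z
  surjective z = from z , λ { refl → trans (f≗g (from z)) (strictlyInverseˡ z) }

module Modular (n : ℕ) where

  infix 4 _≋_
  record _≋_ (x y : ℤ) : Set where
    constructor mk≋
    field n∣x-y : + n ∣ x - y
  open _≋_

  ≋-by : ∀ {x y d} → d ≡ x - y → + n ∣ d → x ≋ y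
  ≋-by refl n∣d = mk≋ n∣d

  ≡⇒≋ : ∀ {x y} → x ≡ y → x ≋ y
  ≡⇒≋ {x} refl = ≋-by (sym (ℤ.+-inverseʳ x)) (divides 0ℤ (sym (ℤ.*-zeroˡ (+ n))))

  ≋-refl : ∀ {x} → x ≋ x
  ≋-refl = ≡⇒≋ refl

  ≋-sym : ∀ {x y} → x ≋ y → y ≋ x
  ≋-sym {x} {y} x≋y = ≋-by (lemma x y) (∣m⇒∣-m (n∣x-y x≋y))
    where lemma : ∀ x y → - (x - y) ≡ y - x
          lemma = ℤ-Solver.solve-∀

  ≋-trans : ∀ {x y z} → x ≋ y → y ≋ z → x ≋ z
  ≋-trans {x} {y} {z} x≋y y≋z = ≋-by (lemma x y z) (∣m∣n⇒∣m+n (n∣x-y x≋y) (n∣x-y y≋z))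
    where lemma : ∀ x y z → x - y ⊕ (y - z) ≡ x - z
          lemma = ℤ-Solver.solve-∀

  +-cong : ∀ {x y u v} → x ≋ y → u ≋ v → x ⊕ u ≋ y ⊕ v
  +-cong {x} {y} {u} {v} x≋y u≋v = ≋-by (lemma x y u v) (∣m∣n⇒∣m+n (n∣x-y x≋y) (n∣x-y u≋v))
    where lemma : ∀ x y u v → x - y ⊕ (u - v) ≡ x ⊕ u - (y ⊕ v)
          lemma = ℤ-Solver.solve-∀

  -‿cong : ∀ {x y} → x ≋ y → - x ≋ - y
  -‿cong {x} {y} x≋y = ≋-by (lemma x y) (∣m⇒∣-m (n∣x-y x≋y))
    where lemma : ∀ x y → - (x - y) ≡ - x - - y
          lemma = ℤ-Solver.solve-∀

  *-cong : ∀ {x y u v} → x ≋ y → u ≋ v → x ⊛ u ≋ y ⊛ v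
  *-cong {x} {y} {u} {v} x≋y u≋v =
    ≋-by (lemma x y u v) (∣m∣n⇒∣m+n (∣m⇒∣m*n u (n∣x-y x≋y)) (∣n⇒∣m*n y (n∣x-y u≋v)))
    where lemma : ∀ x y u v → (x - y) ⊛ u ⊕ y ⊛ (u - v) ≡ x ⊛ u - y ⊛ v
          lemma = ℤ-Solver.solve-∀

  -‿cancelˡ : ∀ x {y z} → x - y ≋ x - z → y ≋ z
  -‿cancelˡ x {y} {z} x-y≋x-z = ≋-by (lemma x y z) (∣m⇒∣-m (n∣x-y x-y≋x-z))
    where lemma : ∀ x y z → - (x - y - (x - z)) ≡ y - z
          lemma = ℤ-Solver.solve-∀

  multiple≋0 : ∀ q → q ⊛ + n ≋ 0ℤ
  multiple≋0 q = ≋-by (sym (ℤ.+-identityʳ (q ⊛ + n))) (divides q refl)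

  n≋0 : + n ≋ 0ℤ
  n≋0 = subst (_≋ 0ℤ) (ℤ.*-identityˡ (+ n)) (multiple≋0 1ℤ)

  +-isAbelianGroup : IsAbelianGroup _≋_ _⊕_ 0ℤ (-_)
  +-isAbelianGroup = record
    { isGroup = record
      { isMonoid = record
        { isSemigroup = record
          { isMagma = record
            { isEquivalence = record { refl = ≋-refl ; sym = ≋-sym ; trans = ≋-trans }
            ; ∙-cong = +-cong
            }
          ; assoc = λ x y z → ≡⇒≋ (ℤ.+-assoc x y z)
          }
        ; identity = (λ x → ≡⇒≋ (ℤ.+-identityˡ x)) , (λ x → ≡⇒≋ (ℤ.+-identityʳ x))
        }
      ; inverse = (λ x → ≡⇒≋ (ℤ.+-inverseˡ x)) , (λ x → ≡⇒≋ (ℤ.+-inverseʳ x))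
      ; ⁻¹-cong = -‿cong
      }
    ; comm = λ x y → ≡⇒≋ (ℤ.+-comm x y)
    }

  +-abelianGroup : AbelianGroup _ _
  +-abelianGroup = record { isAbelianGroup = +-isAbelianGroup }

  open AbelianGroup +-abelianGroup public using (setoid; commutativeMonoid; group)
  open import Algebra.Properties.CommutativeMonoid.Sum commutativeMonoid public using (sum; ∑-distrib-+; sum-permute)
  open import Algebra.Properties.CommutativeMonoid.Sum commutativeMonoid using (sum-cong-≋; sum-remove)
  open import Algebra.Properties.Group group using (∙-cancelʳ)
  open import Relation.Binary.Reasoning.Setoid setoid

  Unit : ℤ → Set
  Unit u = ∃ λ w → w ⊛ u ≋ 1ℤ

  sum-neg : ∀ {k} (f : Fin k → ℤ) → sum (λ i → - f i) ≋ - sum f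
  sum-neg {zero}  f = ≡⇒≋ refl
  sum-neg {suc k} f =
    ≋-trans (+-cong (≋-refl { - head f}) (sum-neg (tail f))) (≡⇒≋ (sym (ℤ.neg-distrib-+ (head f) _)))

  sum-difference≋0 : ∀ {k} (f g : Fin k → ℤ) → sum g ≋ sum f → sum (λ i → f i - g i) ≋ 0ℤ
  sum-difference≋0 f g Σg≋Σf = begin
    sum (λ i → f i - g i)          ≈⟨ ∑-distrib-+ f (λ i → - g i) ⟩
    sum f ⊕ sum (λ i → - g i)      ≈⟨ +-cong (≋-refl {sum f}) (≋-trans (sum-neg g) (-‿cong Σg≋Σf)) ⟩
    sum f - sum f                  ≡⟨ ℤ.+-inverseʳ (sum f) ⟩
    0ℤ                             ∎

  sum-≋-except : ∀ {k} (f g : Fin (suc k) → ℤ) q → sum f ≋ sum g → (∀ i → i ≢ q → f i ≋ g i) → f q ≋ g q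
  sum-≋-except f g q Σf≋Σg f≋g = ∙-cancelʳ (sum (removeAt f q)) (f q) (g q) (begin
    f q ⊕ sum (removeAt f q) ≈⟨ ≋-sym (sum-remove f) ⟩
    sum f                    ≈⟨ Σf≋Σg ⟩
    sum g                    ≈⟨ sum-remove g ⟩
    g q ⊕ sum (removeAt g q) ≈⟨ +-cong (≋-refl {g q}) (sum-cong-≋ λ j → ≋-sym (f≋g (punchIn q j) (punchInᵢ≢i q j))) ⟩
    g q ⊕ sum (removeAt f q) ∎)

  module _ {{_ : NonZero n}} where

    ι : Fin n → ℤ
    ι x = + toℕ x

    %-cong-≤ : ∀ {a b} → b ≤ a → + a ≋ + b → a % n ≡ b % n
    %-cong-≤ {a} {b} b≤a a≋b = trans (cong (_% n) (sym (ℕ.m+[n∸m]≡n b≤a))) (%-remove-+ʳ b n∣a∸b)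
      where
      n∣a∸b : n ℕ.∣ a ∸ b
      n∣a∸b = ∣⇒∣ᵤ (subst (+ n ∣_) (trans (ℤ.m-n≡m⊖n a b) (ℤ.≤-⊖ b≤a)) (n∣x-y a≋b))

    %-cong : ∀ {a b} → + a ≋ + b → a % n ≡ b % n
    %-cong {a} {b} a≋b with ℕ.≤-total b a
    ... | inj₁ b≤a = %-cong-≤ b≤a a≋b
    ... | inj₂ a≤b = sym (%-cong-≤ a≤b (≋-sym a≋b))

    ι-injective : ∀ {x y} → ι x ≋ ι y → x ≡ y
    ι-injective {x} {y} ιx≋ιy =
      toℕ-injective (trans (sym (m<n⇒m%n≡m (toℕ<n x))) (trans (%-cong ιx≋ιy) (m<n⇒m%n≡m (toℕ<n y))))

    reduce : ℤ → Fin n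
    reduce z = fromℕ< (n%ℕd<d z n)

    ι-reduce : ∀ z → ι (reduce z) ≋ z
    ι-reduce z = begin
      ι (reduce z)                     ≡⟨ cong +_ (toℕ-fromℕ< (n%ℕd<d z n)) ⟩
      + (z %ℕ n)                       ≡⟨ ℤ.+-identityʳ (+ (z %ℕ n)) ⟨
      + (z %ℕ n) ⊕ 0ℤ                  ≈⟨ +-cong (≋-refl {+ (z %ℕ n)}) (multiple≋0 (z /ℕ n)) ⟨
      + (z %ℕ n) ⊕ (z /ℕ n) ⊛ + n      ≡⟨ a≡a%ℕn+[a/ℕn]*n z n ⟨
      z                                ∎

    reduce-cong : ∀ {x y} → x ≋ y → reduce x ≡ reduce y
    reduce-cong {x} {y} x≋y = ι-injective (≋-trans (ι-reduce x) (≋-trans x≋y (≋-sym (ι-reduce y))))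

    reduce-ι : ∀ x → reduce (ι x) ≡ x
    reduce-ι x = ι-injective (ι-reduce (ι x))

module Hall (m : ℕ) where

  n : ℕ
  n = suc m

  open Modular n
  open import Relation.Binary.Reasoning.Setoid setoid

  infix 4 _≉_
  _≉_ : ℤ → ℤ → Set
  x ≉ y = ¬ (x ≋ y)

  -- c i − a i ≡ t i for every i except q; when Σ t ≡ 0 the equation at q follows (see hall).
  record Realisation (q : Fin n) (t : Fin n → ℤ) : Set where
    field
      a c : Permutation′ n
      realises : ∀ i → i ≢ q → ι (c ⟨$⟩ʳ i) ≋ ι (a ⟨$⟩ʳ i) ⊕ t i

  -- Hall's exchange walk.  All equations hold except at p and q, and the one at p reads
  -- c p ≡ K − a q.  A step gives p the value K − a q, which c takes at some r, and swaps the
  -- values of a at r and q, so that the defect moves to r.  Positions outside U were visited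
  -- earlier; their values of c differ from K − a i for every unvisited i ≠ p, so r is always
  -- unvisited and the walk ends.
  record WalkState (q : Fin n) (t : Fin n → ℤ) (K : ℤ) (U : Subset n) : Set where
    field
      p : Fin n
      a c : Permutation′ n
      p∈U : p ∈ U
      q∈U : q ∈ U
      p≢q : p ≢ q
      realises : ∀ i → i ≢ p → i ≢ q → ι (c ⟨$⟩ʳ i) ≋ ι (a ⟨$⟩ʳ i) ⊕ t i
      K≋ : K ≋ ι (a ⟨$⟩ʳ p) ⊕ t p ⊕ ι (a ⟨$⟩ʳ q)
      avoids : ∀ s i → s ∉ U → i ∈ U → i ≢ p → ι (c ⟨$⟩ʳ s) ≉ K - ι (a ⟨$⟩ʳ i)

  module Step {q t K U} (S : WalkState q t K U) where
    open WalkState S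

    r : Fin n
    r = c ⟨$⟩ˡ reduce (K - ι (a ⟨$⟩ʳ q))

    c-r : ι (c ⟨$⟩ʳ r) ≋ K - ι (a ⟨$⟩ʳ q)
    c-r = subst (λ x → ι x ≋ K - ι (a ⟨$⟩ʳ q)) (sym (inverseʳ c)) (ι-reduce _)

    r∈U : r ∈ U
    r∈U with r ∈? U
    ... | yes r∈U = r∈U
    ... | no r∉U = contradiction c-r (avoids r q r∉U q∈U (≢-sym p≢q))

    c′ : Permutation′ n
    c′ = transpose p r ∘ₚ c

    c′-p≡c-r : c′ ⟨$⟩ʳ p ≡ c ⟨$⟩ʳ r
    c′-p≡c-r = cong (c ⟨$⟩ʳ_) (transpose-applyˡ p r)

    c′-p : ι (c′ ⟨$⟩ʳ p) ≋ ι (a ⟨$⟩ʳ p) ⊕ t p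
    c′-p = begin
      ι (c′ ⟨$⟩ʳ p)                                 ≡⟨ cong ι c′-p≡c-r ⟩
      ι (c ⟨$⟩ʳ r)                                 ≈⟨ c-r ⟩
      K - ι (a ⟨$⟩ʳ q)                             ≈⟨ +-cong K≋ ≋-refl ⟩
      ι (a ⟨$⟩ʳ p) ⊕ t p ⊕ ι (a ⟨$⟩ʳ q) - ι (a ⟨$⟩ʳ q) ≡⟨ cancel (ι (a ⟨$⟩ʳ p)) (t p) (ι (a ⟨$⟩ʳ q)) ⟩
      ι (a ⟨$⟩ʳ p) ⊕ t p                           ∎
      where cancel : ∀ x y z → x ⊕ y ⊕ z - z ≡ x ⊕ y
            cancel = ℤ-Solver.solve-∀

    c′-≢ : ∀ {i} → i ≢ p → i ≢ r → c′ ⟨$⟩ʳ i ≡ c ⟨$⟩ʳ i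
    c′-≢ i≢p i≢r = cong (c ⟨$⟩ʳ_) (transpose-apply-≢ i≢p i≢r)

    finish : r ≡ p ⊎ r ≡ q → Realisation q t
    finish r∈pq = record { a = a ; c = c′ ; realises = λ i i≢q → realises′ i≢q (i ≟ p) }
      where
      realises′ : ∀ {i} → i ≢ q → Dec (i ≡ p) → ι (c′ ⟨$⟩ʳ i) ≋ ι (a ⟨$⟩ʳ i) ⊕ t i
      realises′ i≢q (yes refl) = c′-p
      realises′ {i} i≢q (no i≢p) = subst (λ x → ι x ≋ ι (a ⟨$⟩ʳ i) ⊕ t i) (sym (c′-≢ i≢p i≢r)) (realises i i≢p i≢q)
        where i≢r : i ≢ r
              i≢r i≡r = [ i≢p , i≢q ] (Sum.map (trans i≡r) (trans i≡r) r∈pq)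

    advance : r ≢ p → r ≢ q → WalkState q t K (U ∖ p)
    advance r≢p r≢q = record
      { p = r ; a = a′ ; c = c′
      ; p∈U = x∈p∧x≢y⇒x∈p-y r∈U r≢p
      ; q∈U = x∈p∧x≢y⇒x∈p-y q∈U (≢-sym p≢q)
      ; p≢q = r≢q
      ; realises = λ i i≢r i≢q → realises′ i≢r i≢q (i ≟ p)
      ; K≋ = K≋′
      ; avoids = λ s i s∉ i∈ i≢r → avoids′ s i s∉ i∈ i≢r (s ≟ p)
      }
      where
      a′ : Permutation′ n
      a′ = transpose r q ∘ₚ a

      a′-≢ : ∀ {i} → i ≢ r → i ≢ q → a′ ⟨$⟩ʳ i ≡ a ⟨$⟩ʳ i
      a′-≢ i≢r i≢q = cong (a ⟨$⟩ʳ_) (transpose-apply-≢ i≢r i≢q)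

      realises-p : ι (c′ ⟨$⟩ʳ p) ≋ ι (a′ ⟨$⟩ʳ p) ⊕ t p
      realises-p = subst (λ x → ι (c′ ⟨$⟩ʳ p) ≋ ι x ⊕ t p) (sym (a′-≢ (≢-sym r≢p) p≢q)) c′-p

      realises′ : ∀ {i} → i ≢ r → i ≢ q → Dec (i ≡ p) → ι (c′ ⟨$⟩ʳ i) ≋ ι (a′ ⟨$⟩ʳ i) ⊕ t i
      realises′ _ _ (yes refl) = realises-p
      realises′ {i} i≢r i≢q (no i≢p) =
        subst₂ (λ x y → ι x ≋ ι y ⊕ t i) (sym (c′-≢ i≢p i≢r)) (sym (a′-≢ i≢r i≢q)) (realises i i≢p i≢q)

      K≋′ : K ≋ ι (a′ ⟨$⟩ʳ r) ⊕ t r ⊕ ι (a′ ⟨$⟩ʳ q)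
      K≋′ = begin
        K                                   ≡⟨ shuffle K (ι (a ⟨$⟩ʳ q)) ⟩
        K - ι (a ⟨$⟩ʳ q) ⊕ ι (a ⟨$⟩ʳ q)       ≈⟨ +-cong (≋-sym c-r) ≋-refl ⟩
        ι (c ⟨$⟩ʳ r) ⊕ ι (a ⟨$⟩ʳ q)           ≈⟨ +-cong (realises r r≢p r≢q) ≋-refl ⟩
        ι (a ⟨$⟩ʳ r) ⊕ t r ⊕ ι (a ⟨$⟩ʳ q)     ≡⟨ swap (ι (a ⟨$⟩ʳ r)) (t r) (ι (a ⟨$⟩ʳ q)) ⟩
        ι (a ⟨$⟩ʳ q) ⊕ t r ⊕ ι (a ⟨$⟩ʳ r)     ≡⟨ cong₂ (λ x y → ι (a ⟨$⟩ʳ x) ⊕ t r ⊕ ι (a ⟨$⟩ʳ y))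
                                                  (transpose-applyˡ r q) (transpose-applyʳ r q) ⟨
        ι (a′ ⟨$⟩ʳ r) ⊕ t r ⊕ ι (a′ ⟨$⟩ʳ q)   ∎
        where shuffle : ∀ x y → x ≡ x - y ⊕ y
              shuffle = ℤ-Solver.solve-∀
              swap : ∀ x y z → x ⊕ y ⊕ z ≡ z ⊕ y ⊕ x
              swap = ℤ-Solver.solve-∀

      avoids-p : ∀ {i} → i ≢ r → ι (c′ ⟨$⟩ʳ p) ≉ K - ι (a′ ⟨$⟩ʳ i)
      avoids-p {i} i≢r c′p≋ = i≢r (sym (⟨$⟩ʳ-injective (transpose r q) (trans (transpose-applyˡ r q) q≡)))
        where
        q≡ : q ≡ transpose r q ⟨$⟩ʳ i
        q≡ = ⟨$⟩ʳ-injective a (ι-injective (-‿cancelˡ K (≋-trans (≋-sym c-r)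
               (subst (λ x → ι x ≋ K - ι (a′ ⟨$⟩ʳ i)) c′-p≡c-r c′p≋))))

      avoids-visited : ∀ {s i} → s ≢ p → s ∉ U → i ∈ U → i ≢ p → i ≢ r → Dec (i ≡ q) →
                       ι (c′ ⟨$⟩ʳ s) ≉ K - ι (a′ ⟨$⟩ʳ i)
      avoids-visited {s} s≢p s∉U _ _ _ (yes refl) =
        avoids s r s∉U r∈U r≢p ∘ subst₂ (λ x y → ι x ≋ K - ι (a ⟨$⟩ʳ y)) (c′-≢ s≢p s≢r) (transpose-applyʳ r q)
        where s≢r : s ≢ r
              s≢r refl = s∉U r∈U
      avoids-visited {s} {i} s≢p s∉U i∈U i≢p i≢r (no i≢q) =
        avoids s i s∉U i∈U i≢p ∘ subst₂ (λ x y → ι x ≋ K - ι y) (c′-≢ s≢p s≢r) (a′-≢ i≢r i≢q)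
        where s≢r : s ≢ r
              s≢r refl = s∉U r∈U

      avoids′ : ∀ s i → s ∉ U ∖ p → i ∈ U ∖ p → i ≢ r → Dec (s ≡ p) → ι (c′ ⟨$⟩ʳ s) ≉ K - ι (a′ ⟨$⟩ʳ i)
      avoids′ s i _ _ i≢r (yes refl) = avoids-p i≢r
      avoids′ s i s∉U∖p i∈U∖p i≢r (no s≢p) =
        avoids-visited s≢p (λ s∈U → s∉U∖p (x∈p∧x≢y⇒x∈p-y s∈U s≢p))
          (p─q⊆p U _ i∈U∖p) (λ { refl → x∉p∖x U p i∈U∖p }) i≢r (i ≟ q)

  walk : ∀ {q t K U} f → ∣ U ∣ ≤ f → WalkState q t K U → Realisation q t
  walk zero ∣U∣≤0 S = contradiction (ℕ.<-≤-trans (x∈p⇒∣p-x∣<∣p∣ (WalkState.p∈U S)) ∣U∣≤0) ℕ.n≮0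
  walk {q} {t} (suc f) ∣U∣≤1+f S = next (r ≟ p) (r ≟ q)
    where
    open WalkState S using (p; p∈U)
    open Step S using (r; finish; advance)
    next : Dec (r ≡ p) → Dec (r ≡ q) → Realisation q t
    next (yes r≡p) _          = finish (inj₁ r≡p)
    next (no _)    (yes r≡q)  = finish (inj₂ r≡q)
    next (no r≢p)  (no r≢q)   = walk f (ℕ.≤-pred (ℕ.<-≤-trans (x∈p⇒∣p-x∣<∣p∣ p∈U) ∣U∣≤1+f)) (advance r≢p r≢q)

  realisation-cong : ∀ {q t t′} → (∀ i → i ≢ q → t i ≡ t′ i) → Realisation q t → Realisation q t′
  realisation-cong t≡t′ R = record
    { a = a ; c = c
    ; realises = λ i i≢q → subst (λ x → ι (c ⟨$⟩ʳ i) ≋ ι (a ⟨$⟩ʳ i) ⊕ x) (t≡t′ i i≢q) (realises i i≢q)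
    }
    where open Realisation R

  realisation-update : ∀ {q t t′} p → (∀ i → i ≢ p → t i ≡ t′ i) → Realisation q t → Realisation q t′
  realisation-update {q} {t} {t′} p t≡t′ R with p ≟ q
  ... | yes refl = realisation-cong t≡t′ R
  ... | no p≢q = walk n (∣p∣≤n ⊤) initial
    where
    open Realisation R
    initial : WalkState q t′ (ι (a ⟨$⟩ʳ p) ⊕ t′ p ⊕ ι (a ⟨$⟩ʳ q)) ⊤
    initial = record
      { p = p ; a = a ; c = c
      ; p∈U = ∈⊤ ; q∈U = ∈⊤ ; p≢q = p≢q
      ; realises = λ i i≢p i≢q →
          subst (λ x → ι (c ⟨$⟩ʳ i) ≋ ι (a ⟨$⟩ʳ i) ⊕ x) (t≡t′ i i≢p) (realises i i≢q)
      ; K≋ = ≡⇒≋ refl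
      ; avoids = λ _ _ s∉⊤ _ _ → contradiction ∈⊤ s∉⊤
      }

  realisation-along : ∀ {q t t′} (L : List (Fin n)) → (∀ i → i ∉ₗ L → t i ≡ t′ i) → Realisation q t → Realisation q t′
  realisation-along [] t≡t′ = realisation-cong (λ i _ → t≡t′ i λ ())
  realisation-along {t = t} {t′} (p List.∷ L) t≡t′ =
    realisation-along L t″≡t′ ∘ realisation-update p (λ i i≢p → sym (updateAt-minimal i p t i≢p))
    where
    t″ : Fin n → ℤ
    t″ = updateAt t p (λ _ → t′ p)
    t″≡t′ : ∀ i → i ∉ₗ L → t″ i ≡ t′ i
    t″≡t′ i i∉L with i ≟ p
    ... | yes refl = updateAt-updates p t
    ... | no i≢p = trans (updateAt-minimal i p t i≢p) (t≡t′ i λ { (Any.here i≡p) → i≢p i≡p ; (Any.there i∈L) → i∉L i∈L })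

  realisation : ∀ q t → Realisation q t
  realisation q t = realisation-along (allFin n) (λ i i∉ → contradiction (∈-allFin i) i∉) trivial
    where
    trivial : Realisation q (λ _ → 0ℤ)
    trivial = record { a = id ; c = id ; realises = λ i _ → ≡⇒≋ (sym (ℤ.+-identityʳ (ι i))) }

  hall : ∀ t → sum t ≋ 0ℤ → ∃₂ λ (a c : Permutation′ n) → ∀ i → ι (c ⟨$⟩ʳ i) ≋ ι (a ⟨$⟩ʳ i) ⊕ t i
  hall t Σt≋0 = a , c , λ i → realises′ i (i ≟ Fin.zero)
    where
    open Realisation (realisation Fin.zero t)
    Σc≋Σa+t : sum (λ i → ι (c ⟨$⟩ʳ i)) ≋ sum (λ i → ι (a ⟨$⟩ʳ i) ⊕ t i)
    Σc≋Σa+t = begin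
      sum (λ i → ι (c ⟨$⟩ʳ i))           ≈⟨ sum-permute ι c ⟨
      sum ι                             ≈⟨ sum-permute ι a ⟩
      sum (λ i → ι (a ⟨$⟩ʳ i))           ≈⟨ ≡⇒≋ (ℤ.+-identityʳ _) ⟨
      sum (λ i → ι (a ⟨$⟩ʳ i)) ⊕ 0ℤ      ≈⟨ +-cong (≋-refl {sum (λ i → ι (a ⟨$⟩ʳ i))}) Σt≋0 ⟨
      sum (λ i → ι (a ⟨$⟩ʳ i)) ⊕ sum t   ≈⟨ ∑-distrib-+ (λ i → ι (a ⟨$⟩ʳ i)) t ⟨
      sum (λ i → ι (a ⟨$⟩ʳ i) ⊕ t i)     ∎
    realises′ : ∀ i → Dec (i ≡ Fin.zero) → ι (c ⟨$⟩ʳ i) ≋ ι (a ⟨$⟩ʳ i) ⊕ t i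
    realises′ i (no i≢0) = realises i i≢0
    realises′ i (yes refl) = sum-≋-except _ _ Fin.zero Σc≋Σa+t realises

select : ∀ {k} → (Fin k → Bool) → (Fin k → ℤ) → Fin k → ℤ
select ε v i = if ε i then v i else 0ℤ

module SubsetSums (n : ℕ) {{_ : NonZero n}} where

  open Modular n
  open import Relation.Binary.Reasoning.Setoid setoid

  infixl 7 _+ₛ_
  _+ₛ_ : Subset n → ℤ → Subset n
  P +ₛ u = tabulate (λ x → lookup P (reduce (ι x - u)))

  ∈-+ₛ⁻ : ∀ P u {x} → x ∈ P +ₛ u → reduce (ι x - u) ∈ P
  ∈-+ₛ⁻ P u {x} x∈P+u = lookup⇒[]= _ P (trans (sym (lookup∘tabulate _ x)) ([]=⇒lookup x∈P+u))

  ∈-+ₛ⁺ : ∀ P u {x} → reduce (ι x - u) ∈ P → x ∈ P +ₛ u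
  ∈-+ₛ⁺ P u {x} x-u∈P = lookup⇒[]= x (P +ₛ u) (trans (lookup∘tabulate _ x) ([]=⇒lookup x-u∈P))

  subsetSums : ∀ {k} → (Fin k → ℤ) → Subset n
  subsetSums {zero}  v = ⁅ reduce 0ℤ ⁆
  subsetSums {suc k} v = subsetSums (tail v) ∪ subsetSums (tail v) +ₛ head v

  0∈subsetSums : ∀ {k} (v : Fin k → ℤ) → reduce 0ℤ ∈ subsetSums v
  0∈subsetSums {zero}  v = x∈⁅x⁆ _
  0∈subsetSums {suc k} v = x∈p∪q⁺ (inj₁ (0∈subsetSums (tail v)))

  ∈-subsetSums : ∀ {k} (v : Fin k → ℤ) {x} → x ∈ subsetSums v → ∃ λ ε → sum (select ε v) ≋ ι x
  ∈-subsetSums {zero} v {x} x∈ =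
    (λ ()) , subst (λ y → 0ℤ ≋ ι y) (sym (x∈⁅y⁆⇒x≡y _ x∈)) (≋-sym (ι-reduce 0ℤ))
  ∈-subsetSums {suc k} v {x} x∈ with x∈p∪q⁻ (subsetSums (tail v)) _ x∈
  ... | inj₁ x∈S = let ε , Σ≋x = ∈-subsetSums (tail v) x∈S in
    false ∷ ε , ≋-trans (≡⇒≋ (ℤ.+-identityˡ _)) Σ≋x
  ... | inj₂ x∈S+u = let ε , Σ≋x-u = ∈-subsetSums (tail v) (∈-+ₛ⁻ (subsetSums (tail v)) (head v) x∈S+u) in
    true ∷ ε , (begin
      head v ⊕ sum (select ε (tail v))     ≈⟨ +-cong (≋-refl {head v}) (≋-trans Σ≋x-u (ι-reduce (ι x - head v))) ⟩
      head v ⊕ (ι x - head v)              ≡⟨ cancel (head v) (ι x) ⟩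
      ι x                                  ∎)
    where cancel : ∀ u y → u ⊕ (y - u) ≡ y
          cancel = ℤ-Solver.solve-∀

  +ₛ-closed⇒⊤ : ∀ {P u} → Unit u → reduce 0ℤ ∈ P → P +ₛ u ⊆ P → ∀ x → x ∈ P
  +ₛ-closed⇒⊤ {P} {u} (w , w*u≋1) 0∈P P+u⊆P x =
    subst (_∈ P) (trans (reduce-cong j*u≋x) (reduce-ι x)) (multiples j)
    where
    step : ∀ {y} → y ∈ P → reduce (ι y ⊕ u) ∈ P
    step {y} y∈P = P+u⊆P (∈-+ₛ⁺ P u (subst (_∈ P) (sym back) y∈P))
      where
      cancel : ∀ y u → y ⊕ u - u ≡ y
      cancel = ℤ-Solver.solve-∀
      back : reduce (ι (reduce (ι y ⊕ u)) - u) ≡ y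
      back = trans (reduce-cong (≋-trans (+-cong (ι-reduce (ι y ⊕ u)) (≋-refl { - u})) (≡⇒≋ (cancel (ι y) u)))) (reduce-ι y)

    multiples : ∀ j → reduce (+ j ⊛ u) ∈ P
    multiples zero    = subst (λ z → reduce z ∈ P) (sym (ℤ.*-zeroˡ u)) 0∈P
    multiples (suc j) = subst (_∈ P) (reduce-cong (begin
      ι (reduce (+ j ⊛ u)) ⊕ u ≈⟨ +-cong (ι-reduce (+ j ⊛ u)) (≋-refl {u}) ⟩
      + j ⊛ u ⊕ u              ≡⟨ distrib (+ j) u ⟩
      (1ℤ ⊕ + j) ⊛ u           ∎)) (step (multiples j))
      where distrib : ∀ a u → a ⊛ u ⊕ u ≡ (1ℤ ⊕ a) ⊛ u
            distrib = ℤ-Solver.solve-∀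

    j : ℕ
    j = toℕ (reduce (ι x ⊛ w))

    j*u≋x : + j ⊛ u ≋ ι x
    j*u≋x = begin
      + j ⊛ u         ≈⟨ *-cong (ι-reduce (ι x ⊛ w)) (≋-refl {u}) ⟩
      ι x ⊛ w ⊛ u     ≈⟨ ≡⇒≋ (ℤ.*-assoc (ι x) w u) ⟩
      ι x ⊛ (w ⊛ u)   ≈⟨ *-cong (≋-refl {ι x}) w*u≋1 ⟩
      ι x ⊛ 1ℤ        ≈⟨ ≡⇒≋ (ℤ.*-identityʳ (ι x)) ⟩
      ι x             ∎

  -- Adjoining a unit u either enlarges the set of subset sums, or leaves it closed under
  -- adding u, and then it is everything since u generates ℤ/n.
  ∣subsetSums∣ : ∀ {k} (v : Fin k → ℤ) → (∀ i → Unit (v i)) → ∣ subsetSums v ∣ ≡ n ⊎ k < ∣ subsetSums v ∣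
  ∣subsetSums∣ {zero} v _ = inj₂ (ℕ.≤-reflexive (sym (∣⁅x⁆∣≡1 (reduce 0ℤ))))
  ∣subsetSums∣ {suc k} v units =
    extend (∣subsetSums∣ (tail v) (units ∘ Fin.suc)) (any? λ x → x ∈? S +ₛ u ×-dec ¬? (x ∈? S))
    where
    S : Subset n
    S = subsetSums (tail v)
    u : ℤ
    u = head v

    grows : (∃ λ x → x ∈ S +ₛ u × x ∉ S) → ∣ S ∣ < ∣ S ∪ S +ₛ u ∣
    grows (x , x∈S+u , x∉S) = p⊂q⇒∣p∣<∣q∣ (p⊆p∪q _ , x , x∈p∪q⁺ (inj₂ x∈S+u) , x∉S)

    full : ¬ (∃ λ x → x ∈ S +ₛ u × x ∉ S) → ∣ S ∪ S +ₛ u ∣ ≡ n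
    full ¬new = trans (cong ∣_∣ (⊆-antisym ⊆⊤ (λ {x} _ → x∈p∪q⁺ (inj₁ (S-full x))))) (∣⊤∣≡n n)
      where
      closed : S +ₛ u ⊆ S
      closed {x} x∈S+u with x ∈? S
      ... | yes x∈S = x∈S
      ... | no x∉S = contradiction (x , x∈S+u , x∉S) ¬new
      S-full : ∀ x → x ∈ S
      S-full = +ₛ-closed⇒⊤ (units Fin.zero) (0∈subsetSums (tail v)) closed

    extend : ∣ S ∣ ≡ n ⊎ k < ∣ S ∣ → Dec (∃ λ x → x ∈ S +ₛ u × x ∉ S) → ∣ S ∪ S +ₛ u ∣ ≡ n ⊎ suc k < ∣ S ∪ S +ₛ u ∣
    extend _ (no ¬new) = inj₁ (full ¬new)
    extend (inj₂ k<∣S∣) (yes new) = inj₂ (ℕ.<-≤-trans (s≤s k<∣S∣) (grows new))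
    extend (inj₁ ∣S∣≡n) (yes new) =
      contradiction (∣p∣≤n (S ∪ S +ₛ u)) (ℕ.<⇒≱ (subst (_< ∣ S ∪ S +ₛ u ∣) ∣S∣≡n (grows new)))

  subset-sum : (v : Fin n → ℤ) → (∀ i → Unit (v i)) → ∀ G → ∃ λ ε → sum (select ε v) ≋ G
  subset-sum v units G with ∣subsetSums∣ v units
  ... | inj₂ n<∣S∣ = contradiction (∣p∣≤n (subsetSums v)) (ℕ.<⇒≱ n<∣S∣)
  ... | inj₁ ∣S∣≡n =
    let ε , Σ≋G = ∈-subsetSums v (subst (reduce G ∈_) (sym (∣p∣≡n⇒p≡⊤ ∣S∣≡n)) ∈⊤)
    in ε , ≋-trans Σ≋G (ι-reduce G)

module Parity (s : ℕ) where

  s*2≡s+s : s * 2 ≡ s + s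
  s*2≡s+s = lemma s
    where lemma : ∀ s → s * 2 ≡ s + s
          lemma = ℕ-Solver.solve-∀

  halves : (Fin s ⊎ Fin s) ↔ (Fin s × Fin 2)
  halves = mk↔ₛ′ to from to-from from-to
    where
    to : Fin s ⊎ Fin s → Fin s × Fin 2
    to (inj₁ a) = a , 0F
    to (inj₂ c) = c , 1F
    from : Fin s × Fin 2 → Fin s ⊎ Fin s
    from (a , 0F) = inj₁ a
    from (c , 1F) = inj₂ c
    to-from : ∀ p → to (from p) ≡ p
    to-from (_ , 0F) = refl
    to-from (_ , 1F) = refl
    from-to : ∀ w → from (to w) ≡ w
    from-to (inj₁ _) = refl
    from-to (inj₂ _) = refl

  combining : (Fin s × Fin 2) ↔ Fin (s + s)
  combining = mk↔ₛ′ to from to-from from-to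
    where
    to : Fin s × Fin 2 → Fin (s + s)
    to = cast s*2≡s+s ∘ uncurry combine
    from : Fin (s + s) → Fin s × Fin 2
    from = remQuot 2 ∘ cast (sym s*2≡s+s)
    to-from : ∀ z → to (from z) ≡ z
    to-from z = trans (cong (cast s*2≡s+s) (combine-remQuot {s} 2 _)) (cast-involutive s*2≡s+s _ z)
    from-to : ∀ p → from (to p) ≡ p
    from-to (a , j) = trans (cong (remQuot 2) (cast-involutive _ s*2≡s+s _)) (remQuot-combine a j)

  parity : (Fin s ⊎ Fin s) ↔ Fin (s + s)
  parity = combining ↔-∘ halves

  toℕ-parity-inj₁ : ∀ a → toℕ (Inverse.to parity (inj₁ a)) ≡ 2 * toℕ a + 0
  toℕ-parity-inj₁ a = trans (toℕ-cast _ (combine a 0F)) (toℕ-combine a 0F)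

  toℕ-parity-inj₂ : ∀ c → toℕ (Inverse.to parity (inj₂ c)) ≡ 2 * toℕ c + 1
  toℕ-parity-inj₂ c = trans (toℕ-cast _ (combine c 1F)) (toℕ-combine c 1F)

pos-2*+ : ∀ a j → + (2 * a + j) ≡ + 2 ⊛ + a ⊕ + j
pos-2*+ a j = trans (ℤ.pos-+ (2 * a) j) (cong (_⊕ + j) (ℤ.pos-* 2 a))

pos-1+* : ∀ a b → + (1 + a * b) ≡ 1ℤ ⊕ + a ⊛ + b
pos-1+* a b = trans (ℤ.pos-+ 1 (a * b)) (cong (1ℤ ⊕_) (ℤ.pos-* a b))

coprime-to-double⇒odd : ∀ s {d} → Coprime d (s + s) → d ≡ 1 + d / 2 * 2
coprime-to-double⇒odd s {d} d⊥2s with d % 2 in d%2≡ | m%n<n d 2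
... | 0 | _ = contradiction (d⊥2s (ℕ.m%n≡0⇒n∣m d 2 d%2≡ , ℕ.divides s (lemma s))) λ ()
  where lemma : ∀ s → s + s ≡ s * 2
        lemma = ℕ-Solver.solve-∀
... | 1 | _ = trans (m≡m%n+[m/n]*n d 2) (cong (_+ d / 2 * 2) d%2≡)
... | suc (suc _) | s≤s (s≤s ())

coprime-to-double⇒unit : ∀ s {d} → Coprime d (s + s) → Modular.Unit s (+ d)
coprime-to-double⇒unit s {d} d⊥2s with coprime-Bézout {d} {s} (λ (k∣d , k∣s) → d⊥2s (k∣d , ℕ.∣m∣n⇒∣m+n k∣s k∣s))
... | Bézout.+- x y eq = + x , mk≋ (divides (+ y) (begin
  + x ⊛ + d - 1ℤ           ≡⟨ cong (_- 1ℤ) (ℤ.pos-* x d) ⟨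
  + (x * d) - 1ℤ           ≡⟨ cong (λ z → + z - 1ℤ) eq ⟨
  + (1 + y * s) - 1ℤ       ≡⟨ cong (_- 1ℤ) (pos-1+* y s) ⟩
  1ℤ ⊕ + y ⊛ + s - 1ℤ      ≡⟨ lemma (+ y) (+ s) ⟩
  + y ⊛ + s                ∎))
  where
  open Modular s using (mk≋)
  open ≡-Reasoning
  lemma : ∀ y s → 1ℤ ⊕ y ⊛ s - 1ℤ ≡ y ⊛ s
  lemma = ℤ-Solver.solve-∀
... | Bézout.-+ x y eq = - + x , mk≋ (divides (- + y) (begin
  - + x ⊛ + d - 1ℤ         ≡⟨ lemma₁ (+ x) (+ d) ⟩
  - (1ℤ ⊕ + x ⊛ + d)       ≡⟨ cong -_ (pos-1+* x d) ⟨
  - + (1 + x * d)          ≡⟨ cong (λ z → - + z) eq ⟩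
  - + (y * s)              ≡⟨ cong -_ (ℤ.pos-* y s) ⟩
  - (+ y ⊛ + s)            ≡⟨ lemma₂ (+ y) (+ s) ⟩
  - + y ⊛ + s              ∎))
  where
  open Modular s using (mk≋)
  open ≡-Reasoning
  lemma₁ : ∀ x d → - x ⊛ d - 1ℤ ≡ - (1ℤ ⊕ x ⊛ d)
  lemma₁ = ℤ-Solver.solve-∀
  lemma₂ : ∀ y s → - (y ⊛ s) ≡ - y ⊛ s
  lemma₂ = ℤ-Solver.solve-∀

2*-cong : ∀ {s x y} → Modular._≋_ s x y → Modular._≋_ (s + s) (+ 2 ⊛ x) (+ 2 ⊛ y)
2*-cong {s} {x} {y} (Modular.mk≋ (divides q eq)) = Modular.mk≋ (divides q (begin
  + 2 ⊛ x - + 2 ⊛ y   ≡⟨ lemma₁ x y ⟩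
  + 2 ⊛ (x - y)       ≡⟨ cong (+ 2 ⊛_) eq ⟩
  + 2 ⊛ (q ⊛ + s)     ≡⟨ lemma₂ q (+ s) ⟩
  q ⊛ (+ s ⊕ + s)     ≡⟨ cong (q ⊛_) (ℤ.pos-+ s s) ⟨
  q ⊛ + (s + s)       ∎))
  where
  open ≡-Reasoning
  lemma₁ : ∀ x y → + 2 ⊛ x - + 2 ⊛ y ≡ + 2 ⊛ (x - y)
  lemma₁ = ℤ-Solver.solve-∀
  lemma₂ : ∀ q s → + 2 ⊛ (q ⊛ s) ≡ q ⊛ (s ⊕ s)
  lemma₂ = ℤ-Solver.solve-∀

≋⇒subMod≡ : ∀ N (x y : Fin (suc N)) {r} → r < suc N → Modular._≋_ (suc N) (+ toℕ x - + toℕ y) (+ r) → subMod N x y ≡ r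
≋⇒subMod≡ N x y {r} r<N x-y≋r = trans (%-cong K≋r) (m<n⇒m%n≡m r<N)
  where
  open Modular (suc N)
  open import Relation.Binary.Reasoning.Setoid setoid
  X Y : ℕ
  X = toℕ x
  Y = toℕ y
  shuffle : ∀ x n y → x ⊕ (n - y) ≡ x - y ⊕ n
  shuffle = ℤ-Solver.solve-∀
  K≋r : + (X + (suc N ∸ Y)) ≋ + r
  K≋r = begin
    + (X + (suc N ∸ Y))      ≡⟨ ℤ.pos-+ X (suc N ∸ Y) ⟩
    + X ⊕ + (suc N ∸ Y)      ≡⟨ cong (+ X ⊕_) (ℤ.⊖-≥ (ℕ.<⇒≤ (toℕ<n y))) ⟨
    + X ⊕ (suc N ⊖ Y)        ≡⟨ cong (+ X ⊕_) (ℤ.m-n≡m⊖n (suc N) Y) ⟨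
    + X ⊕ (+ suc N - + Y)    ≡⟨ shuffle (+ X) (+ suc N) (+ Y) ⟩
    + X - + Y ⊕ + suc N      ≈⟨ +-cong x-y≋r n≋0 ⟩
    + r ⊕ 0ℤ                 ≡⟨ ℤ.+-identityʳ (+ r) ⟩
    + r                      ∎

-- Pair i is {2 a i, 2 c i + 1}, and ε i says whether its first element x i is the even one.
module Matching (s : ℕ) (ε : Fin s → Bool) (a c : Permutation′ s) where

  orient : (Fin s ⊎ Fin s) ↔ (Fin s ⊎ Fin s)
  orient = mk↔ₛ′ swap swap swap-involutive swap-involutive
    where
    swap : Fin s ⊎ Fin s → Fin s ⊎ Fin s
    swap (inj₁ i) = if ε i then inj₁ i else inj₂ i
    swap (inj₂ i) = if ε i then inj₂ i else inj₁ i
    swap-involutive : ∀ w → swap (swap w) ≡ w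
    swap-involutive (inj₁ i) with ε i in εi
    ... | true rewrite εi = refl
    ... | false rewrite εi = refl
    swap-involutive (inj₂ i) with ε i in εi
    ... | true rewrite εi = refl
    ... | false rewrite εi = refl

  matching : (Fin s ⊎ Fin s) ↔ Fin (s + s)
  matching = Parity.parity s ↔-∘ ((a ⊎-↔ c) ↔-∘ orient)

  even odd : Fin s → Fin (s + s)
  even α = Inverse.to (Parity.parity s) (inj₁ α)
  odd γ = Inverse.to (Parity.parity s) (inj₂ γ)

  x y : Fin s → Fin (s + s)
  x i = if ε i then even (a ⟨$⟩ʳ i) else odd (c ⟨$⟩ʳ i)
  y i = if ε i then odd (c ⟨$⟩ʳ i) else even (a ⟨$⟩ʳ i)

  [x,y]≗matching : [ x , y ] ≗ Inverse.to matching
  [x,y]≗matching (inj₁ i) with ε i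
  ... | true = refl
  ... | false = refl
  [x,y]≗matching (inj₂ i) with ε i
  ... | true = refl
  ... | false = refl

  open Modular (s + s) using (_≋_; ≋-refl; +-cong; -‿cong; setoid)
  open import Relation.Binary.Reasoning.Setoid setoid

  odd-minus-even : ∀ {γ α} t → Modular._≋_ s (+ toℕ γ) (+ toℕ α ⊕ t) →
                   + toℕ (odd γ) - + toℕ (even α) ≋ + 2 ⊛ t ⊕ 1ℤ
  odd-minus-even {γ} {α} t γ≋α+t = begin
    + toℕ (odd γ) - + toℕ (even α)          ≡⟨ cong₂ _-_ (ι-odd γ) (ι-even α) ⟩
    + 2 ⊛ C ⊕ 1ℤ - (+ 2 ⊛ A ⊕ 0ℤ)           ≈⟨ +-cong (+-cong (2*-cong γ≋α+t) (≋-refl {1ℤ})) (≋-refl { - (+ 2 ⊛ A ⊕ 0ℤ)}) ⟩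
    + 2 ⊛ (A ⊕ t) ⊕ 1ℤ - (+ 2 ⊛ A ⊕ 0ℤ)     ≡⟨ lemma A t ⟩
    + 2 ⊛ t ⊕ 1ℤ                            ∎
    where
    A C : ℤ
    A = + toℕ α
    C = + toℕ γ
    ι-even : ∀ α → + toℕ (even α) ≡ + 2 ⊛ + toℕ α ⊕ 0ℤ
    ι-even α = trans (cong +_ (Parity.toℕ-parity-inj₁ s α)) (pos-2*+ (toℕ α) 0)
    ι-odd : ∀ γ → + toℕ (odd γ) ≡ + 2 ⊛ + toℕ γ ⊕ 1ℤ
    ι-odd γ = trans (cong +_ (Parity.toℕ-parity-inj₂ s γ)) (pos-2*+ (toℕ γ) 1)
    lemma : ∀ A t → + 2 ⊛ (A ⊕ t) ⊕ 1ℤ - (+ 2 ⊛ A ⊕ 0ℤ) ≡ + 2 ⊛ t ⊕ 1ℤ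
    lemma = ℤ-Solver.solve-∀

  difference : ∀ i {d h} → d ≡ 1 + h * 2 →
               Modular._≋_ s (+ toℕ (c ⟨$⟩ʳ i)) (+ toℕ (a ⟨$⟩ʳ i) ⊕ (+ h - (if ε i then + d else 0ℤ))) →
               + toℕ (x i) - + toℕ (y i) ≋ + d
  difference i {h = h} refl c≋a+t with ε i
  ... | true = begin
    + toℕ (even α) - + toℕ (odd γ)            ≡⟨ swap-sides (+ toℕ (even α)) (+ toℕ (odd γ)) ⟩
    - (+ toℕ (odd γ) - + toℕ (even α))        ≈⟨ -‿cong (odd-minus-even (+ h - + (1 + h * 2)) c≋a+t) ⟩
    - (+ 2 ⊛ (+ h - + (1 + h * 2)) ⊕ 1ℤ)     ≡⟨ cong (λ d → - (+ 2 ⊛ (+ h - d) ⊕ 1ℤ)) (pos-1+* h 2) ⟩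
    - (+ 2 ⊛ (+ h - (1ℤ ⊕ + h ⊛ + 2)) ⊕ 1ℤ)  ≡⟨ lemma (+ h) ⟩
    1ℤ ⊕ + h ⊛ + 2                           ≡⟨ pos-1+* h 2 ⟨
    + (1 + h * 2)                            ∎
    where
    α γ : Fin s
    α = a ⟨$⟩ʳ i
    γ = c ⟨$⟩ʳ i
    swap-sides : ∀ u v → u - v ≡ - (v - u)
    swap-sides = ℤ-Solver.solve-∀
    lemma : ∀ h → - (+ 2 ⊛ (h - (1ℤ ⊕ h ⊛ + 2)) ⊕ 1ℤ) ≡ 1ℤ ⊕ h ⊛ + 2
    lemma = ℤ-Solver.solve-∀
  ... | false = begin
    + toℕ (odd (c ⟨$⟩ʳ i)) - + toℕ (even (a ⟨$⟩ʳ i)) ≈⟨ odd-minus-even (+ h - 0ℤ) c≋a+t ⟩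
    + 2 ⊛ (+ h - 0ℤ) ⊕ 1ℤ                        ≡⟨ lemma (+ h) ⟩
    1ℤ ⊕ + h ⊛ + 2                               ≡⟨ pos-1+* h 2 ⟨
    + (1 + h * 2)                                ∎
    where
    lemma : ∀ h → + 2 ⊛ (h - 0ℤ) ⊕ 1ℤ ≡ 1ℤ ⊕ h ⊛ + 2
    lemma = ℤ-Solver.solve-∀

theorem2p5 : (m : ℕ) (d : Fin (suc m) → Fin (suc (m + suc m))) →
    ((i : Fin (suc m)) → Coprime (toℕ (d i)) (suc (m + suc m))) →
    ∃₂ λ (x y : Fin (suc m) → Fin (suc (m + suc m))) →
      Bijective _≡_ _≡_ [ x , y ] ×
      ((i : Fin (suc m)) → subMod (m + suc m) (x i) (y i) ≡ toℕ (d i))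
theorem2p5 m d d⊥2s =
  x , y , bijective-≗ matching [x,y]≗matching ,
  λ i → ≋⇒subMod≡ _ (x i) (y i) (toℕ<n (d i)) (difference i (coprime-to-double⇒odd (suc m) (d⊥2s i)) (c≋a+t i))
  where
  open Modular (suc m) using (_≋_; ι; sum; sum-difference≋0)
  h v : Fin (suc m) → ℤ
  h i = + (toℕ (d i) / 2)
  v i = + toℕ (d i)
  choice : ∃ λ ε → sum (select ε v) ≋ sum h
  choice = SubsetSums.subset-sum (suc m) v (λ i → coprime-to-double⇒unit (suc m) (d⊥2s i)) (sum h)
  ε : Fin (suc m) → Bool
  ε = proj₁ choice
  t : Fin (suc m) → ℤ
  t i = h i - select ε v i
  solution : ∃₂ λ (a c : Permutation′ (suc m)) → ∀ i → ι (c ⟨$⟩ʳ i) ≋ ι (a ⟨$⟩ʳ i) ⊕ t i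
  solution = Hall.hall m t (sum-difference≋0 h (select ε v) (proj₂ choice))
  a c : Permutation′ (suc m)
  a = proj₁ solution
  c = proj₁ (proj₂ solution)
  c≋a+t : ∀ i → ι (c ⟨$⟩ʳ i) ≋ ι (a ⟨$⟩ʳ i) ⊕ t i
  c≋a+t = proj₂ (proj₂ solution)
  open Matching (suc m) ε a c
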